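{- Let $n,t$ be positive integers with $t\geqslant 2$ and $t$ dividing $n$, and let $1\leqslant h<t$. Let $G$ be the $t$-subdivided prism of $K_{n/t}$; it has exactly $n$ vertices, and we identify its vertex set with the vertex set of $K_n$ (so $G$ is a spanning subgraph of $K_n$, and its bottom layer is a copy of $K_{n/t}$). Let $S$ be an odd set and $M$ a perfect matching of $K_{n/t}$ (identified with the bottom layer $u^1_1,\dots,u^1_{n/t}$). Suppose $|S|\geqslant 5$ and that $w_1,w_2,w_3,w_4\in S$ are distinct with $(w_1,w_2)\in M$ and $(w_3,w_4)\in M$. Then there exist a comb $C$ (handle $H$, teeth $T_1,\dots,T_k$) in $K_n$ and a TSP tour $T$ of $K_n$ such that: (C1) $C$ is an $(h,t)$-uniform comb; (C2) $C$ depends only on $S$ and the two edges $(w_1,w_2),(w_3,w_4)$ of $M$; (C3) $T$ depends only on $M$; (C4) $\mathrm{sl}_{\mathrm{comb}}(C,T)=\mathrm{sl}_{\mathrm{odd}}(S,M)$.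
   Context: For a graph and a vertex subset $S$, $\delta(S)$ is the set of edges with exactly one endpoint in $S$. A TSP tour of $K_n$ is a Hamiltonian cycle. A comb in $K_n$ consists of a vertex set $H$ (the handle) and vertex sets $T_1,\dots,T_k$ (the teeth), $k\geqslant 3$ odd, with $H\cap T_i\neq\emptyset$ for all $i$, $T_i\cap T_j=\emptyset$ for $i\neq j$, and $H\setminus\bigcup_i T_i\neq\emptyset$; its comb inequality $x(\delta(H))+\sum_{i=1}^k x(\delta(T_i))\geqslant 3k+1$ is valid for the TSP polytope. For a comb $C$ and tour $T$, $\mathrm{sl}_{\mathrm{comb}}(C,T)=|\delta(H)\cap T|+\sum_{i=1}^k|\delta(T_i)\cap T|-(3k+1)$. A comb is $(h,t)$-uniform if $|T_i|=t$ and $|H\cap T_i|=h$ for all $i$. An odd set is a vertex subset $U$ of odd cardinality; the odd set inequality $x(\delta(U))\geqslant 1$ is valid for the perfect matching polytope, and for a perfect matching $M$, $\mathrm{sl}_{\mathrm{odd}}(U,M)=|\delta(U)\cap M|-1$. The $t$-subdivided prism of $K_m$: take two copies of $K_m$ with vertices $u^1_1,\dots,u^1_m$ and $u^t_1,\dots,u^t_m$, and for each $i$ join $u^1_i$ to $u^t_i$ by a path $u^1_i,u^2_i,\dots,u^t_i$ through $t-2$ new vertices; it has $tm$ vertices and $2\binom{m}{2}+(t-1)m$ edges. -}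

module Defs where

open import Data.Nat using (ℕ; zero; suc; _+_; _*_; _≤_; _<_; _%_)
open import Data.Integer using (ℤ; _⊖_)
open import Data.Bool using (Bool; true; false; _xor_; not; _∧_)
open import Data.Fin using (Fin)
open import Data.Fin.Subset using (Subset; _∈_; _∉_; _∩_; ∣_∣; Nonempty)
open import Data.Fin.Permutation using (Permutation′; _⟨$⟩ʳ_)
open import Data.Vec using (lookup)
open import Data.List using (List; []; _∷_; map; length; filter)
open import Data.Nat.ListAction using () renaming (sum to listSum)
open import Data.List.Base using (allFin)
open import Data.Product using (_×_; _,_; Σ; ∃)
open import Relation.Binary.PropositionalEquality using (_≡_; _≢_)
open import Relation.Nullary using (¬_)
open import Data.Bool.Properties using (T?)
open import Data.Bool using (T)

Odd : ℕ → Set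
Odd k = k % 2 ≡ 1

inS : ∀ {n} → Subset n → Fin n → Bool
inS S v = lookup S v

crosses : ∀ {n} → Subset n → Fin n → Fin n → Bool
crosses S u v = inS S u xor inS S v

count : ∀ {A : Set} → (A → Bool) → List A → ℕ
count p xs = length (filter (λ x → T? (p x)) xs)

-- TSP tours of K_n: a Hamiltonian cycle, given by a cyclic ordering
-- (a permutation σ of the vertices); its edges are
-- {σ 0, σ 1}, {σ 1, σ 2}, …, {σ (n-1), σ 0}.

Tour : ℕ → Set
Tour n = Permutation′ n

cycleEdges : ∀ {A : Set} → List A → List (A × A)
cycleEdges {A} [] = []
cycleEdges {A} (x ∷ xs) = go (x ∷ xs)
  where
  go : List A → List (A × A)
  go [] = []
  go (y ∷ []) = (y , x) ∷ []
  go (y ∷ z ∷ r) = (y , z) ∷ go (z ∷ r)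

tourEdges : ∀ {n} → Tour n → List (Fin n × Fin n)
tourEdges {n} σ = cycleEdges (map (σ ⟨$⟩ʳ_) (allFin n))

cutTour : ∀ {n} → Subset n → Tour n → ℕ
cutTour S σ = count (λ e → crosses S (Data.Product.proj₁ e) (Data.Product.proj₂ e)) (tourEdges σ)

record Comb (n : ℕ) : Set where
  field
    handle : Subset n
    k      : ℕ
    teeth  : Fin k → Subset n
open Comb public

IsComb : ∀ {n} → Comb n → Set
IsComb C =
  (3 ≤ k C) × Odd (k C)
  × (∀ i → Nonempty (handle C ∩ teeth C i))
  × (∀ i j → i ≢ j → ∀ v → v ∈ teeth C i → v ∉ teeth C j)
  × ∃ (λ v → v ∈ handle C × (∀ i → v ∉ teeth C i))

IsUniformComb : ∀ {n} → ℕ → ℕ → Comb n → Set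
IsUniformComb h t C =
  IsComb C × (∀ i → ∣ teeth C i ∣ ≡ t) × (∀ i → ∣ handle C ∩ teeth C i ∣ ≡ h)

sumFin : ∀ {k} → (Fin k → ℕ) → ℕ
sumFin {k} f = listSum (map f (allFin k))

slComb : ∀ {n} → Comb n → Tour n → ℤ
slComb C σ = (cutTour (handle C) σ + sumFin (λ i → cutTour (teeth C i) σ)) ⊖ (3 * k C + 1)

-- Perfect matchings of K_m: each vertex v is matched to partner v,
-- the matching edges being the pairs {v, partner v}.

record PerfectMatching (m : ℕ) : Set where
  field
    partner     : Fin m → Fin m
    involutive  : ∀ v → partner (partner v) ≡ v
    noFixpoint  : ∀ v → partner v ≢ v
open PerfectMatching public

InMatching : ∀ {m} → PerfectMatching m → Fin m → Fin m → Set
InMatching M u v = partner M u ≡ v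

-- |δ(U) ∩ M|: each matching edge in δ(U) is counted once, via its
-- unique endpoint lying in U.
cutMatching : ∀ {m} → Subset m → PerfectMatching m → ℕ
cutMatching {m} U M = count (λ v → inS U v ∧ not (inS U (partner M v))) (allFin m)

slOdd : ∀ {m} → Subset m → PerfectMatching m → ℤ
slOdd U M = cutMatching U M ⊖ 1

module Submission where

-- Vertices of K_n, n = m·t with t = h + r, are pairs (column c, level j), c ∈ Fin m,
-- j ∈ Fin t: the t-subdivided prism of K_m.  Levels below h form the lower half
-- of a column.  For a perfect matching M the tour runs, edge {v, p v} after edge,
-- up column v, across {v, p v} on the top level and down column p v.  For S the
-- teeth are the columns of S, the handle the lower halves of these columns
-- together with all other columns.  So C depends only on S, T only on M.

open import Defs
open import Data.Nat using (ℕ; zero; suc; _+_; _*_; _≤_; _<_; s≤s; z≤n; _%_)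
open import Data.Nat.Properties using (+-identityʳ; +-suc; *-comm; ≤-trans; m≤n⇒∃[o]m+o≡n)
open import Data.Nat.DivMod using (m*n%n≡0)
open import Data.Nat.ListAction using (sum)
open import Data.Nat.Tactic.RingSolver using (solve-∀)
open import Data.Integer using (_⊖_)
open import Data.Integer.Properties using (+-cancelˡ-⊖)
open import Data.Bool using (Bool; true; false; not; _∧_; _xor_)
import Data.Bool as Bool
open import Data.Bool.Properties using (T?; T-≡; ¬-not; ∧-identityʳ; ∧-zeroʳ)
open import Data.Empty using (⊥; ⊥-elim)
open import Data.Fin using (Fin; zero; suc; cast; combine; remQuot; splitAt; _↑ˡ_; _↑ʳ_; fromℕ<; _<?_)
import Data.Fin as Fin
open import Data.Fin.Properties
  using (suc-injective; cast-is-id; remQuot-combine; splitAt-↑ˡ; splitAt-↑ʳ; ¬∀⟶∃¬; <-cmp; <-asym)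
open import Data.Fin.Permutation using (Permutation′; _⟨$⟩ʳ_; _∘ₚ_; cast-id)
open import Data.Fin.Subset using (Subset; ∣_∣; ⁅_⁆; _∩_; _∈_; _∉_; Nonempty)
open import Data.Fin.Subset.Properties using (x∈⁅x⁆; x∈⁅y⁆⇒x≡y; ∣⁅x⁆∣≡1)
open import Data.List
  using (List; []; _∷_; _++_; _∷ʳ_; concat; concatMap; map; length; filter; drop; tabulate; allFin; reverse; lookup)
open import Data.List.Properties
  using ( filter-++; length-++; ++-assoc; ++-identityʳ; concat-++; map-tabulate; map-cong; tabulate-cong
        ; tabulate-lookup; length-tabulate; length-reverse; reverse-++)
open import Data.List.Membership.Propositional using () renaming (_∈_ to _∈ₗ_; _∉_ to _∉ₗ_)
open import Data.List.Membership.Propositional.Properties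
  using (∈-lookup; ∈-filter⁺; ∈-filter⁻; ∈-allFin; ∈-map⁺; ∈-map⁻; ∈-++⁺ˡ; ∈-++⁺ʳ)
open import Data.List.Membership.Propositional.Properties.WithK using (unique∧set⇒bag)
open import Data.List.Relation.Binary.BagAndSetEquality using (∼bag⇒↭)
open import Data.List.Relation.Binary.Permutation.Propositional
  using (_↭_; ↭-refl; ↭-reflexive; ↭-sym; ↭-trans; ↭-prep; ↭⇒↭ₛ)
import Data.List.Relation.Binary.Permutation.Propositional as ↭
import Data.List.Relation.Binary.Permutation.Propositional.Properties as ↭
import Data.List.Relation.Binary.Permutation.Setoid as Setoid↭
import Data.List.Relation.Binary.Permutation.Setoid.Properties as Setoid↭
open import Data.List.Relation.Binary.Pointwise using (Pointwise; []; _∷_) renaming (++⁺ to pointwise-++⁺)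
open import Data.List.Relation.Unary.All using (All; []; _∷_)
import Data.List.Relation.Unary.All as All
open import Data.List.Relation.Unary.All.Properties using (tabulate⁺)
open import Data.List.Relation.Unary.Any using (here; there)
open import Data.List.Relation.Unary.Unique.Propositional using (Unique; []; _∷_)
import Data.List.Relation.Unary.Unique.Propositional.Properties as Unique
open import Data.Vec using (_∷_; [])
import Data.Vec as Vec
open import Data.Vec.Properties using (lookup∘tabulate; lookup⇒[]=; []=⇒lookup; lookup-zipWith)
open import Data.Product using (Σ; ∃; _×_; _,_; proj₁; proj₂; uncurry)
open import Data.Sum using ([_,_]′)
open import Function using (const)
open import Function.Bundles using (mk⇔; Equivalence)
open import Relation.Binary.Definitions using (tri<; tri≈; tri>)
open import Relation.Binary.PropositionalEquality
open import Relation.Binary.PropositionalEquality.Properties using (setoid)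
open ≡-Reasoning

bit : Bool → ℕ
bit true  = 1
bit false = 0

count-∷ : ∀ {A : Set} (p : A → Bool) x xs → count p (x ∷ xs) ≡ bit (p x) + count p xs
count-∷ p x xs with p x
... | true  = refl
... | false = refl

count-++ : ∀ {A : Set} (p : A → Bool) xs ys → count p (xs ++ ys) ≡ count p xs + count p ys
count-++ p xs ys = trans (cong length (filter-++ (λ x → T? (p x)) xs ys)) (length-++ (filter _ xs))

count-↭ : ∀ {A : Set} (p : A → Bool) {xs ys} → xs ↭ ys → count p xs ≡ count p ys
count-↭ p xs↭ys = ↭.↭-length (↭.filter-↭ (λ x → T? (p x)) xs↭ys)

count-map : ∀ {A B : Set} (p : B → Bool) (f : A → B) xs → count p (map f xs) ≡ count (λ x → p (f x)) xs
count-map p f []       = refl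
count-map p f (x ∷ xs) = trans (count-∷ p (f x) (map f xs))
  (trans (cong (bit (p (f x)) +_) (count-map p f xs)) (sym (count-∷ (λ x → p (f x)) x xs)))

count-tabulate : ∀ {B : Set} {n} (p : B → Bool) (f : Fin n → B) → count p (tabulate f) ≡ count (λ i → p (f i)) (allFin n)
count-tabulate p f = trans (cong (count p) (sym (map-tabulate (λ i → i) f))) (count-map p f (allFin _))

count-cong : ∀ {A : Set} {p q : A → Bool} → (∀ x → p x ≡ q x) → ∀ xs → count p xs ≡ count q xs
count-cong p≗q []       = refl
count-cong {p = p} {q} p≗q (x ∷ xs) = trans (count-∷ p x xs)
  (trans (cong₂ _+_ (cong bit (p≗q x)) (count-cong p≗q xs)) (sym (count-∷ q x xs)))

count-true : ∀ {A : Set} (xs : List A) → count (λ _ → true) xs ≡ length xs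
count-true []       = refl
count-true (x ∷ xs) = cong suc (count-true xs)

count-false : ∀ {A : Set} (xs : List A) → count (λ _ → false) xs ≡ 0
count-false []       = refl
count-false (x ∷ xs) = count-false xs

count-concat : ∀ {A : Set} (p : A → Bool) xss → count p (concat xss) ≡ sum (map (count p) xss)
count-concat p []         = refl
count-concat p (xs ∷ xss) = trans (count-++ p xs (concat xss)) (cong (count p xs +_) (count-concat p xss))

card-count : ∀ {n} (X : Subset n) → ∣ X ∣ ≡ count (inS X) (allFin n)
card-count []          = refl
card-count (b ∷ X) = trans (step b) (sym (trans (count-∷ (inS (b ∷ X)) zero (tabulate suc))
                                         (cong (bit b +_) (count-tabulate (inS (b ∷ X)) suc))))
  where
  step : ∀ b → ∣ b ∷ X ∣ ≡ bit b + count (inS X) (allFin _)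
  step true  = cong suc (card-count X)
  step false = card-count X

inS-∩ : ∀ {n} (A B : Subset n) w → inS (A ∩ B) w ≡ inS A w ∧ inS B w
inS-∩ A B w = lookup-zipWith _∧_ w A B

∈⇒inS : ∀ {n} {X : Subset n} {w} → w ∈ X → inS X w ≡ true
∈⇒inS = []=⇒lookup

inS⇒∈ : ∀ {n} {X : Subset n} {w} → inS X w ≡ true → w ∈ X
inS⇒∈ {X = X} {w} = lookup⇒[]= w X

lookup-injective : ∀ {A : Set} {xs : List A} → Unique xs → ∀ i j → lookup xs i ≡ lookup xs j → i ≡ j
lookup-injective {xs = x ∷ xs} _              zero    zero    _ = refl
lookup-injective {xs = x ∷ xs} (x∉ ∷ _)       zero    (suc j) e = ⊥-elim (All.lookup x∉ (∈-lookup j) e)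
lookup-injective {xs = x ∷ xs} (x∉ ∷ _)       (suc i) zero    e = ⊥-elim (All.lookup x∉ (∈-lookup i) (sym e))
lookup-injective {xs = x ∷ xs} (_ ∷ unique)   (suc i) (suc j) e = cong suc (lookup-injective unique i j e)

∈⁅⁆⇒≡ : ∀ {n} {u c : Fin n} → inS ⁅ u ⁆ c ≡ true → c ≡ u
∈⁅⁆⇒≡ {u = u} c∈ = x∈⁅y⁆⇒x≡y u (inS⇒∈ c∈)

u∈⁅u⁆ : ∀ {n} (u : Fin n) → inS ⁅ u ⁆ u ≡ true
u∈⁅u⁆ u = ∈⇒inS (x∈⁅x⁆ u)

∉⁅u⁆ : ∀ {n} {u c : Fin n} → c ≢ u → inS ⁅ u ⁆ c ≡ false
∉⁅u⁆ {u = u} {c} c≢u with inS ⁅ u ⁆ c in c∈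
... | true  = ⊥-elim (c≢u (∈⁅⁆⇒≡ c∈))
... | false = refl

sum-const : ∀ {A : Set} c (xs : List A) → sum (map (λ _ → c) xs) ≡ length xs * c
sum-const c []       = refl
sum-const c (x ∷ xs) = cong (c +_) (sum-const c xs)

sum-point : ∀ {n} (u : Fin n) (F : Fin n → ℕ) → (∀ c → c ≢ u → F c ≡ 0) → sum (tabulate F) ≡ F u
sum-point zero    F F≡0 = trans (cong (F zero +_) (sum-zero (λ c → F (suc c)) (λ c → F≡0 (suc c) (λ ())))) (+-identityʳ _)
  where
  sum-zero : ∀ {n} (G : Fin n → ℕ) → (∀ c → G c ≡ 0) → sum (tabulate G) ≡ 0
  sum-zero {zero}  G G≡0 = refl
  sum-zero {suc n} G G≡0 = cong₂ _+_ (G≡0 zero) (sum-zero (λ c → G (suc c)) (λ c → G≡0 (suc c)))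
sum-point (suc u) F F≡0 = trans (cong (_+ sum (tabulate (λ c → F (suc c)))) (F≡0 zero (λ ())))
                                (sum-point u (λ c → F (suc c)) (λ c c≢u → F≡0 (suc c) (λ e → c≢u (suc-injective e))))

-- Crossings of a cyclic sequence.  For a vertex set given by its indicator f,
-- the crossing edges of a cyclic sequence are the places where f changes value.

change : Bool → Bool → ℕ
change a b = bit (a xor b)

change-self : ∀ a → change a a ≡ 0
change-self true  = refl
change-self false = refl

steps : ∀ {A : Set} → A → List A → List (A × A)
steps x []       = []
steps x (y ∷ ys) = (x , y) ∷ steps y ys

module _ {A : Set} (f : A → Bool) where

  changes : Bool → List A → ℕ
  changes b []       = 0
  changes b (x ∷ xs) = change b (f x) + changes (f x) xs

  changes-run : ∀ {b} xs ys → All (λ x → f x ≡ b) xs → changes b (xs ++ ys) ≡ changes b ys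
  changes-run {b} []       ys []           = refl
  changes-run {b} (x ∷ xs) ys (fx≡b ∷ run) rewrite fx≡b =
    cong₂ _+_ (change-self b) (changes-run xs ys run)

  crossing : A × A → Bool
  crossing e = f (proj₁ e) xor f (proj₂ e)

  count-steps : ∀ x ys → count crossing (steps x ys) ≡ changes (f x) ys
  count-steps x []       = refl
  count-steps x (y ∷ ys) = trans (count-∷ crossing (x , y) (steps y ys)) (cong (change (f x) (f y) +_) (count-steps y ys))

cycleEdges-steps : ∀ {A : Set} (x : A) xs → cycleEdges (x ∷ xs) ≡ steps x (xs ∷ʳ x)
cycleEdges-steps x []           = refl
cycleEdges-steps x (y ∷ [])     = refl
cycleEdges-steps x (y ∷ z ∷ zs) = cong (λ es → (x , y) ∷ (y , z) ∷ drop 1 es) (cycleEdges-steps x (z ∷ zs))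

cyc : ∀ {A : Set} → (A → Bool) → List A → ℕ
cyc f L = count (crossing f) (cycleEdges L)

cyc-closed : ∀ {A : Set} (f : A → Bool) x xs → cyc f (x ∷ xs) ≡ changes f (f x) (x ∷ xs ∷ʳ x)
cyc-closed f x xs = begin
  count (crossing f) (cycleEdges (x ∷ xs)) ≡⟨ cong (count (crossing f)) (cycleEdges-steps x xs) ⟩
  count (crossing f) (steps x (xs ∷ʳ x))  ≡⟨ count-steps f x (xs ∷ʳ x) ⟩
  changes f (f x) (xs ∷ʳ x)                ≡⟨ cong (_+ changes f (f x) (xs ∷ʳ x)) (change-self (f x)) ⟨
  changes f (f x) (x ∷ xs ∷ʳ x)            ∎

Run : ∀ {A : Set} → (A → Bool) → Bool → List A → Set
Run f b B = All (λ x → f x ≡ b) B × 1 ≤ length B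

Run-reverse : ∀ {A : Set} {f : A → Bool} {b} B → Run f b B → Run f b (reverse B)
Run-reverse B (constant , nonempty) =
  ↭.All-resp-↭ (↭-sym (↭.↭-reverse B)) constant , subst (1 ≤_) (sym (length-reverse B)) nonempty

module _ {A C : Set} (f : A → Bool) (g : C → Bool) where

  Inflation : List (List A) → List C → Set
  Inflation = Pointwise (λ B c → Run f (g c) B)

  changes-inflate : ∀ b {Bs cs} → Inflation Bs cs → changes f b (concat Bs) ≡ changes g b cs
  changes-inflate b [] = refl
  changes-inflate b {(x ∷ xs) ∷ Bs} {c ∷ cs} ((fx≡gc ∷ run , _) ∷ Bs~cs) = begin
    change b (f x) + changes f (f x) (xs ++ concat Bs) ≡⟨ cong (λ v → change b v + changes f v (xs ++ concat Bs)) fx≡gc ⟩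
    change b (g c) + changes f (g c) (xs ++ concat Bs) ≡⟨ cong (change b (g c) +_) (changes-run f xs (concat Bs) run) ⟩
    change b (g c) + changes f (g c) (concat Bs)       ≡⟨ cong (change b (g c) +_) (changes-inflate (g c) Bs~cs) ⟩
    change b (g c) + changes g (g c) cs                ∎

  cyc-inflate : ∀ {Bs cs} → Inflation Bs cs → cyc f (concat Bs) ≡ cyc g cs
  cyc-inflate [] = refl
  cyc-inflate {(x ∷ xs) ∷ Bs} {c ∷ cs} Bs~cs@((fx≡gc ∷ _ , _) ∷ _) = begin
    cyc f (x ∷ xs ++ concat Bs)
      ≡⟨ cyc-closed f x (xs ++ concat Bs) ⟩
    changes f (f x) (x ∷ (xs ++ concat Bs) ∷ʳ x)
      ≡⟨ cong (λ l → changes f (f x) (x ∷ l)) (closing xs) ⟩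
    changes f (f x) (concat (((x ∷ xs) ∷ Bs) ∷ʳ (x ∷ [])))
      ≡⟨ changes-inflate (f x) (pointwise-++⁺ Bs~cs ((fx≡gc ∷ [] , s≤s z≤n) ∷ [])) ⟩
    changes g (f x) (c ∷ cs ∷ʳ c)
      ≡⟨ cong (λ v → changes g v (c ∷ cs ∷ʳ c)) fx≡gc ⟩
    changes g (g c) (c ∷ cs ∷ʳ c)
      ≡⟨ cyc-closed g c cs ⟨
    cyc g (c ∷ cs) ∎
    where
    closing : ∀ ys → (ys ++ concat Bs) ∷ʳ x ≡ ys ++ concat (Bs ∷ʳ (x ∷ []))
    closing ys = trans (++-assoc ys (concat Bs) (x ∷ [])) (cong (ys ++_) (concat-++ Bs ((x ∷ []) ∷ [])))

  inflation-concatMap : ∀ {X : Set} {B : X → List (List A)} {D : X → List C} →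
                        (∀ x → Inflation (B x) (D x)) → ∀ xs → Inflation (concatMap B xs) (concatMap D xs)
  inflation-concatMap B~D []       = []
  inflation-concatMap B~D (x ∷ xs) = pointwise-++⁺ (B~D x) (inflation-concatMap B~D xs)

concatMap-blocks : ∀ {X A : Set} (s : X → List A) (B : X → List (List A)) →
                   (∀ x → s x ≡ concat (B x)) → ∀ xs → concatMap s xs ≡ concat (concatMap B xs)
concatMap-blocks s B s≡ []       = refl
concatMap-blocks s B s≡ (x ∷ xs) = trans (cong₂ _++_ (s≡ x) (concatMap-blocks s B s≡ xs)) (concat-++ (B x) (concatMap B xs))

module _ {A : Set} (g : A → Bool) (single : ∀ {a b} → g a ≡ true → g b ≡ true → a ≡ b) where

  change-distinct : ∀ {a b} → a ≢ b → change (g a) (g b) ≡ bit (g a) + bit (g b)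
  change-distinct {a} {b} a≢b with g a in ga | g b in gb
  ... | true  | true  = ⊥-elim (a≢b (single ga gb))
  ... | true  | false = refl
  ... | false | true  = refl
  ... | false | false = refl

  -- along a duplicate-free walk every occurrence of the g-element, except at
  -- the two ends, accounts for two changes
  changes-unique : ∀ x zs y → Unique (x ∷ zs) → y ∉ₗ x ∷ zs →
                   changes g (g x) (zs ∷ʳ y) ≡ count g (x ∷ zs) + count g (zs ∷ʳ y)
  changes-unique x []       y _ y∉ = begin
    change (g x) (g y) + 0                ≡⟨ cong (_+ 0) (change-distinct (λ x≡y → y∉ (here (sym x≡y)))) ⟩
    bit (g x) + bit (g y) + 0             ≡⟨ arrange (bit (g x)) (bit (g y)) ⟩
    (bit (g x) + 0) + (bit (g y) + 0)     ≡⟨ cong₂ _+_ (count-∷ g x []) (count-∷ g y []) ⟨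
    count g (x ∷ []) + count g (y ∷ [])   ∎
    where
    arrange : ∀ a b → a + b + 0 ≡ (a + 0) + (b + 0)
    arrange = solve-∀
  changes-unique x (z ∷ zs) y (x≢ ∷ unique) y∉ = begin
    change (g x) (g z) + changes g (g z) (zs ∷ʳ y)
      ≡⟨ cong₂ _+_ (change-distinct (All.head x≢)) (changes-unique z zs y unique (λ i → y∉ (there i))) ⟩
    (bit (g x) + bit (g z)) + (count g (z ∷ zs) + count g (zs ∷ʳ y))
      ≡⟨ arrange (bit (g x)) (bit (g z)) (count g (z ∷ zs)) (count g (zs ∷ʳ y)) ⟩
    (bit (g x) + count g (z ∷ zs)) + (bit (g z) + count g (zs ∷ʳ y))
      ≡⟨ cong₂ _+_ (count-∷ g x (z ∷ zs)) (count-∷ g z (zs ∷ʳ y)) ⟨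
    count g (x ∷ z ∷ zs) + count g (z ∷ zs ∷ʳ y) ∎
    where
    arrange : ∀ a b c d → (a + b) + (c + d) ≡ (a + c) + (b + d)
    arrange = solve-∀

  cyc-point : ∀ x z zs → Unique (x ∷ z ∷ zs) → cyc g (x ∷ z ∷ zs) ≡ 2 * count g (x ∷ z ∷ zs)
  cyc-point x z zs (x≢ ∷ unique) = begin
    cyc g (x ∷ z ∷ zs)
      ≡⟨ cyc-closed g x (z ∷ zs) ⟩
    change (g x) (g x) + (change (g x) (g z) + changes g (g z) (zs ∷ʳ x))
      ≡⟨ cong₂ _+_ (change-self (g x)) (cong₂ _+_ (change-distinct (All.head x≢)) (changes-unique z zs x unique x∉)) ⟩
    0 + ((a + b) + (count g (z ∷ zs) + count g (zs ∷ʳ x)))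
      ≡⟨ cong₂ (λ p q → 0 + ((a + b) + (p + q)))
               (count-∷ g z zs) (trans (count-++ g zs (x ∷ [])) (cong (s +_) (count-∷ g x []))) ⟩
    0 + ((a + b) + ((b + s) + (s + (a + 0))))
      ≡⟨ arrange a b s ⟩
    2 * (a + (b + s))
      ≡⟨ cong (λ n → 2 * n) (trans (count-∷ g x (z ∷ zs)) (cong (a +_) (count-∷ g z zs))) ⟨
    2 * count g (x ∷ z ∷ zs) ∎
    where
    a = bit (g x)
    b = bit (g z)
    s = count g zs
    x∉ : x ∉ₗ z ∷ zs
    x∉ i = All.lookup x≢ i refl
    arrange : ∀ a b s → 0 + ((a + b) + ((b + s) + (s + (a + 0)))) ≡ 2 * (a + (b + s))
    arrange = solve-∀

tabulate-++ : ∀ {B : Set} a {b} (f : Fin (a + b) → B) →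
              tabulate f ≡ tabulate (λ i → f (i ↑ˡ b)) ++ tabulate (λ i → f (a ↑ʳ i))
tabulate-++ zero    f = refl
tabulate-++ (suc a) f = cong (f zero ∷_) (tabulate-++ a (λ i → f (suc i)))

tabulate-combine : ∀ {B : Set} m t (f : Fin (m * t) → B) →
                   concat (tabulate {n = m} (λ c → tabulate {n = t} (λ j → f (combine c j)))) ≡ tabulate f
tabulate-combine zero    t f = refl
tabulate-combine (suc m) t f = begin
  tabulate (λ j → f (j ↑ˡ m * t)) ++ concat (tabulate {n = m} (λ c → tabulate {n = t} (λ j → f (t ↑ʳ combine c j))))
    ≡⟨ cong (tabulate (λ j → f (j ↑ˡ m * t)) ++_) (tabulate-combine m t (λ i → f (t ↑ʳ i))) ⟩
  tabulate (λ j → f (j ↑ˡ m * t)) ++ tabulate (λ i → f (t ↑ʳ i))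
    ≡⟨ tabulate-++ t f ⟨
  tabulate f ∎

concatMap-↭ : ∀ {A B : Set} (f : A → List B) {xs ys} → xs ↭ ys → concatMap f xs ↭ concatMap f ys
concatMap-↭ f ↭.refl          = ↭-refl
concatMap-↭ f (↭.prep x p)    = ↭.++⁺ˡ (f x) (concatMap-↭ f p)
concatMap-↭ f (↭.swap x y p)  = ↭-trans (↭.++⁺ˡ (f x) (↭.++⁺ˡ (f y) (concatMap-↭ f p))) (↭.shifts (f x) (f y))
concatMap-↭ f (↭.trans p q)   = ↭-trans (concatMap-↭ f p) (concatMap-↭ f q)

lookup-tabulate′ : ∀ {B : Set} {n} (f : Fin n → B) k → lookup (tabulate f) k ≡ f (cast (length-tabulate f) k)
lookup-tabulate′ {n = suc n} f zero    = refl
lookup-tabulate′ {n = suc n} f (suc k) = lookup-tabulate′ (λ i → f (suc i)) k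

map-lookup : ∀ {B : Set} {n} (L : List B) (e : n ≡ length L) → map (λ i → lookup L (cast e i)) (allFin n) ≡ L
map-lookup L refl = begin
  map (λ i → lookup L (cast refl i)) (allFin (length L))
    ≡⟨ map-cong (λ i → cong (lookup L) (cast-is-id refl i)) (allFin (length L)) ⟩
  map (lookup L) (allFin (length L))
    ≡⟨ map-tabulate (λ i → i) (lookup L) ⟩
  tabulate (lookup L)
    ≡⟨ tabulate-lookup L ⟩
  L ∎

permutationOf : ∀ {n} (L : List (Fin n)) → L ↭ allFin n → Σ (Permutation′ n) λ σ → map (σ ⟨$⟩ʳ_) (allFin n) ≡ L
permutationOf {n} L L↭ = σ , trans (map-cong σ-lookup (allFin n)) (map-lookup L (sym len))
  where
  len : length L ≡ n
  len = trans (↭.↭-length L↭) (length-tabulate (λ i → i))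
  L↭ₛ = ↭⇒↭ₛ L↭
  π = Setoid↭.onIndices L↭ₛ
  σ : Permutation′ n
  σ = cast-id (sym len) ∘ₚ (π ∘ₚ cast-id (length-tabulate (λ i → i)))
  σ-lookup : ∀ i → σ ⟨$⟩ʳ i ≡ lookup L (cast (sym len) i)
  σ-lookup i = sym (trans (Setoid↭.onIndices-lookup (setoid (Fin n)) L↭ₛ (cast (sym len) i))
                          (lookup-tabulate′ (λ i → i) _))

-- Every vertex occurs exactly once in
-- edgeOrder, which is what makes the tour below a Hamiltonian cycle and lets
-- sums over edges of M be rewritten as sums over vertices.
module EdgeOrder {m : ℕ} (M : PerfectMatching m) where

  p : Fin m → Fin m
  p = partner M

  p-injective : ∀ {x y} → p x ≡ p y → x ≡ y
  p-injective {x} {y} px≡py = trans (sym (involutive M x)) (trans (cong p px≡py) (involutive M y))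

  lowerEnds : List (Fin m)
  lowerEnds = filter (λ v → v <? p v) (allFin m)

  edgeOrder : List (Fin m)
  edgeOrder = concatMap (λ v → v ∷ p v ∷ []) lowerEnds

  edgeOrder-split : ∀ vs → concatMap (λ v → v ∷ p v ∷ []) vs ↭ vs ++ map p vs
  edgeOrder-split []       = ↭-refl
  edgeOrder-split (v ∷ vs) = ↭-prep v (↭-trans (↭-prep (p v) (edgeOrder-split vs)) (↭-sym (↭.shift (p v) vs (map p vs))))

  lowerEnds-lower : ∀ {v} → v ∈ₗ lowerEnds → v Fin.< p v
  lowerEnds-lower v∈ = proj₂ (∈-filter⁻ (λ v → v <? p v) {xs = allFin m} v∈)

  ends-complete : ∀ v → v ∈ₗ lowerEnds ++ map p lowerEnds
  ends-complete v with <-cmp v (p v)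
  ... | tri< v<pv _ _ = ∈-++⁺ˡ (∈-filter⁺ (λ v → v <? p v) (∈-allFin v) v<pv)
  ... | tri≈ _ v≡pv _ = ⊥-elim (noFixpoint M v (sym v≡pv))
  ... | tri> _ _ pv<v = ∈-++⁺ʳ lowerEnds (subst (_∈ₗ map p lowerEnds) (involutive M v) (∈-map⁺ p pv-lower))
    where
    pv-lower : p v ∈ₗ lowerEnds
    pv-lower = ∈-filter⁺ (λ v → v <? p v) (∈-allFin (p v)) (subst (p v Fin.<_) (sym (involutive M v)) pv<v)

  ends-unique : Unique (lowerEnds ++ map p lowerEnds)
  ends-unique = Unique.++⁺ lowers-unique (Unique.map⁺ p-injective lowers-unique) disjoint
    where
    lowers-unique : Unique lowerEnds
    lowers-unique = Unique.filter⁺ (λ v → v <? p v) (Unique.allFin⁺ m)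
    disjoint : ∀ {v} → v ∈ₗ lowerEnds × v ∈ₗ map p lowerEnds → ⊥
    disjoint (v∈ , v∈p) with ∈-map⁻ p v∈p
    ... | w , w∈ , refl = <-asym (lowerEnds-lower w∈) (subst (p w Fin.<_) (involutive M w) (lowerEnds-lower v∈))

  edgeOrder-↭ : edgeOrder ↭ allFin m
  edgeOrder-↭ = ↭-trans (edgeOrder-split lowerEnds)
    (∼bag⇒↭ (unique∧set⇒bag ends-unique (Unique.allFin⁺ m) (mk⇔ (λ _ → ∈-allFin _) (λ _ → ends-complete _))))

  edgeOrder-unique : Unique edgeOrder
  edgeOrder-unique = Setoid↭.Unique-resp-↭ (setoid (Fin m)) (↭⇒↭ₛ (↭-sym edgeOrder-↭)) (Unique.allFin⁺ m)

  even : m ≡ length lowerEnds * 2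
  even = trans (sym (length-tabulate (λ v → v))) (trans (sym (↭.↭-length edgeOrder-↭)) (length-pairs lowerEnds))
    where
    length-pairs : ∀ vs → length (concatMap (λ v → v ∷ p v ∷ []) vs) ≡ length vs * 2
    length-pairs []       = refl
    length-pairs (v ∷ vs) = cong (λ l → suc (suc l)) (length-pairs vs)

-- The t-subdivided prism of K_m, t = h + r: vertex c j is level j of column c,
-- the columns being the subdivided edges between the two copies of K_m.
module Prism (m h r : ℕ) where

  t : ℕ
  t = h + r

  vertex : Fin m → Fin t → Fin (m * t)
  vertex = combine

  column : Fin m → List (Fin (m * t))
  column c = tabulate (vertex c)

  data Half : Set where
    lower upper : Half

  half : Fin t → Half
  half j = [ const lower , const upper ]′ (splitAt h j)

  lowerPart upperPart : Fin m → List (Fin (m * t))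
  lowerPart c = tabulate (λ i → vertex c (i ↑ˡ r))
  upperPart c = tabulate (λ i → vertex c (h ↑ʳ i))

  half-lower : ∀ i → half (i ↑ˡ r) ≡ lower
  half-lower i = cong [ const lower , const upper ]′ (splitAt-↑ˡ h i r)

  half-upper : ∀ i → half (h ↑ʳ i) ≡ upper
  half-upper i = cong [ const lower , const upper ]′ (splitAt-↑ʳ h r i)

  column-halves : ∀ c → column c ≡ lowerPart c ++ upperPart c
  column-halves c = tabulate-++ h (vertex c)

  region : (Fin m → Fin t → Bool) → Subset (m * t)
  region φ = Vec.tabulate (λ w → uncurry φ (remQuot t w))

  region-vertex : ∀ φ c j → inS (region φ) (vertex c j) ≡ φ c j
  region-vertex φ c j = trans (lookup∘tabulate _ (vertex c j)) (cong (uncurry φ) (remQuot-combine c j))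

  card-columns : (X : Subset (m * t)) (φ : Fin m → Fin t → Bool) → (∀ c j → inS X (vertex c j) ≡ φ c j) →
                 ∣ X ∣ ≡ sum (tabulate (λ c → count (φ c) (allFin t)))
  card-columns X φ X≡φ = begin
    ∣ X ∣                                                       ≡⟨ card-count X ⟩
    count (inS X) (allFin (m * t))                              ≡⟨ cong (count (inS X)) (tabulate-combine m t (λ w → w)) ⟨
    count (inS X) (concat (tabulate column))                    ≡⟨ count-concat (inS X) (tabulate column) ⟩
    sum (map (count (inS X)) (tabulate column))                 ≡⟨ cong sum (map-tabulate column (count (inS X))) ⟩
    sum (tabulate (λ c → count (inS X) (column c)))             ≡⟨ cong sum (tabulate-cong (λ c → count-column c)) ⟩
    sum (tabulate (λ c → count (φ c) (allFin t)))               ∎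
    where
    count-column : ∀ c → count (inS X) (column c) ≡ count (φ c) (allFin t)
    count-column c = trans (count-tabulate (inS X) (vertex c)) (count-cong (X≡φ c) (allFin t))

  handleHalf : Subset m → Fin m × Half → Bool
  handleHalf S (c , lower) = true
  handleHalf S (c , upper) = not (inS S c)

  handleFor : Subset m → Subset (m * t)
  handleFor S = region (λ c j → handleHalf S (c , half j))

  toothAt : Fin m → Subset (m * t)
  toothAt u = region (λ c _ → inS ⁅ u ⁆ c)

  handleFor-vertex : ∀ S c j → inS (handleFor S) (vertex c j) ≡ handleHalf S (c , half j)
  handleFor-vertex S = region-vertex (λ c j → handleHalf S (c , half j))

  toothAt-vertex : ∀ u c j → inS (toothAt u) (vertex c j) ≡ inS ⁅ u ⁆ c
  toothAt-vertex u = region-vertex (λ c _ → inS ⁅ u ⁆ c)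

  module MatchingTour (M : PerfectMatching m) where
    open EdgeOrder M

    segment : Fin m → List (Fin (m * t))
    segment v = column v ++ reverse (column (p v))

    tourOrder : List (Fin (m * t))
    tourOrder = concatMap segment lowerEnds

    segments-↭ : ∀ vs → concatMap segment vs ↭ concatMap column (concatMap (λ v → v ∷ p v ∷ []) vs)
    segments-↭ []       = ↭-refl
    segments-↭ (v ∷ vs) = ↭-trans
      (↭.++⁺ (↭.++⁺ˡ (column v) (↭.↭-reverse (column (p v)))) (segments-↭ vs))
      (↭-reflexive (++-assoc (column v) (column (p v)) _))

    tourOrder-↭ : tourOrder ↭ allFin (m * t)
    tourOrder-↭ = ↭-trans (segments-↭ lowerEnds) (↭-trans (concatMap-↭ column edgeOrder-↭)
      (↭-reflexive (trans (cong concat (map-tabulate (λ c → c) column)) (tabulate-combine m t (λ w → w)))))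

    tour : Tour (m * t)
    tour = proj₁ (permutationOf tourOrder tourOrder-↭)

    cut-cyc : ∀ X → cutTour X tour ≡ cyc (inS X) tourOrder
    cut-cyc X = cong (cyc (inS X)) (proj₂ (permutationOf tourOrder tourOrder-↭))

    halfBlocks : Fin m → List (List (Fin (m * t)))
    halfBlocks v = lowerPart v ∷ upperPart v ∷ reverse (upperPart (p v)) ∷ reverse (lowerPart (p v)) ∷ []

    halfOrder : Fin m → List (Fin m × Half)
    halfOrder v = (v , lower) ∷ (v , upper) ∷ (p v , upper) ∷ (p v , lower) ∷ []

    segment-halves : ∀ v → segment v ≡ concat (halfBlocks v)
    segment-halves v = begin
      column v ++ reverse (column (p v))
        ≡⟨ cong₂ _++_ (column-halves v)
                      (trans (cong reverse (column-halves (p v))) (reverse-++ (lowerPart (p v)) (upperPart (p v)))) ⟩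
      (lowerPart v ++ upperPart v) ++ (reverse (upperPart (p v)) ++ reverse (lowerPart (p v)))
        ≡⟨ ++-assoc (lowerPart v) (upperPart v) _ ⟩
      lowerPart v ++ upperPart v ++ reverse (upperPart (p v)) ++ reverse (lowerPart (p v))
        ≡⟨ cong (λ l → lowerPart v ++ upperPart v ++ reverse (upperPart (p v)) ++ l)
                (++-identityʳ (reverse (lowerPart (p v)))) ⟨
      concat (halfBlocks v) ∎

    cyc-halves : 1 ≤ h → 1 ≤ r → (f : Fin (m * t) → Bool) (g : Fin m × Half → Bool) →
                 (∀ c j → f (vertex c j) ≡ g (c , half j)) → cyc f tourOrder ≡ cyc g (concatMap halfOrder lowerEnds)
    cyc-halves h≥1 r≥1 f g f≡g = begin
      cyc f (concatMap segment lowerEnds)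
        ≡⟨ cong (cyc f) (concatMap-blocks segment halfBlocks segment-halves lowerEnds) ⟩
      cyc f (concat (concatMap halfBlocks lowerEnds))
        ≡⟨ cyc-inflate f g (inflation-concatMap f g blocks lowerEnds) ⟩
      cyc g (concatMap halfOrder lowerEnds) ∎
      where
      lowerRun : ∀ c → Run f (g (c , lower)) (lowerPart c)
      lowerRun c = tabulate⁺ (λ i → trans (f≡g c (i ↑ˡ r)) (cong (λ x → g (c , x)) (half-lower i)))
                 , subst (1 ≤_) (sym (length-tabulate _)) h≥1
      upperRun : ∀ c → Run f (g (c , upper)) (upperPart c)
      upperRun c = tabulate⁺ (λ i → trans (f≡g c (h ↑ʳ i)) (cong (λ x → g (c , x)) (half-upper i)))
                 , subst (1 ≤_) (sym (length-tabulate _)) r≥1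
      blocks : ∀ v → Inflation f g (halfBlocks v) (halfOrder v)
      blocks v = lowerRun v ∷ upperRun v ∷ Run-reverse _ (upperRun (p v)) ∷ Run-reverse _ (lowerRun (p v)) ∷ []

    -- Every column is a contiguous piece of the tour: each tooth is crossed twice.
    cut-tooth : 1 ≤ h → 1 ≤ r → ∀ u → cutTour (toothAt u) tour ≡ 2
    cut-tooth h≥1 r≥1 u = begin
      cutTour (toothAt u) tour
        ≡⟨ cut-cyc (toothAt u) ⟩
      cyc (inS (toothAt u)) tourOrder
        ≡⟨ cyc-halves h≥1 r≥1 (inS (toothAt u)) inColumn (toothAt-vertex u) ⟩
      cyc inColumn (concatMap halfOrder lowerEnds)
        ≡⟨ cong (cyc inColumn) (concatMap-blocks halfOrder pairBlocks (λ _ → refl) lowerEnds) ⟩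
      cyc inColumn (concat (concatMap pairBlocks lowerEnds))
        ≡⟨ cyc-inflate inColumn (inS ⁅ u ⁆) (inflation-concatMap inColumn (inS ⁅ u ⁆) pairRuns lowerEnds) ⟩
      cyc (inS ⁅ u ⁆) edgeOrder
        ≡⟨ cyc-edges lowerEnds edgeOrder-unique ⟩
      2 * count (inS ⁅ u ⁆) edgeOrder
        ≡⟨ cong (2 *_) (count-↭ (inS ⁅ u ⁆) edgeOrder-↭) ⟩
      2 * count (inS ⁅ u ⁆) (allFin m)
        ≡⟨ cong (2 *_) (trans (sym (card-count ⁅ u ⁆)) (∣⁅x⁆∣≡1 u)) ⟩
      2 ∎
      where
      inColumn : Fin m × Half → Bool
      inColumn (c , _) = inS ⁅ u ⁆ c
      pairBlocks : Fin m → List (List (Fin m × Half))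
      pairBlocks v = ((v , lower) ∷ (v , upper) ∷ []) ∷ ((p v , upper) ∷ (p v , lower) ∷ []) ∷ []
      pairRuns : ∀ v → Inflation inColumn (inS ⁅ u ⁆) (pairBlocks v) (v ∷ p v ∷ [])
      pairRuns v = (refl ∷ refl ∷ [] , s≤s z≤n) ∷ (refl ∷ refl ∷ [] , s≤s z≤n) ∷ []
      single : ∀ {a b} → inS ⁅ u ⁆ a ≡ true → inS ⁅ u ⁆ b ≡ true → a ≡ b
      single a∈ b∈ = trans (∈⁅⁆⇒≡ {u = u} a∈) (sym (∈⁅⁆⇒≡ {u = u} b∈))
      cyc-edges : ∀ vs → let es = concatMap (λ v → v ∷ p v ∷ []) vs in
                  Unique es → cyc (inS ⁅ u ⁆) es ≡ 2 * count (inS ⁅ u ⁆) es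
      cyc-edges []       _      = refl
      cyc-edges (v ∷ vs) unique = cyc-point (inS ⁅ u ⁆) single v (p v) _ unique

    -- The changes of the handle indicator along the half-columns of one edge
    -- {v, p v}, with a = [v ∈ S] and b = [p v ∈ S]: one change inside each column
    -- of S, and one on the top level exactly when the edge leaves S.
    edge-cost : ∀ a b → change true (not a) + (change (not a) (not b) + change (not b) true)
                        ≡ (bit a + bit b) + (bit (a ∧ not b) + bit (b ∧ not a))
    edge-cost true  true  = refl
    edge-cost true  false = refl
    edge-cost false true  = refl
    edge-cost false false = refl

    module _ (S : Subset m) where

      leaves : Fin m → Bool
      leaves v = inS S v ∧ not (inS S (p v))

      walk-handle : ∀ vs c → let es = concatMap (λ v → v ∷ p v ∷ []) vs in
                    changes (handleHalf S) true (concatMap halfOrder vs ∷ʳ (c , lower)) ≡ count (inS S) es + count leaves es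
      walk-handle []       c = refl
      walk-handle (v ∷ vs) c = begin
        0 + (change true (not a) + (change (not a) (not b) + (change (not b) true + W)))
          ≡⟨ arrange₁ (change true (not a)) (change (not a) (not b)) (change (not b) true) W ⟩
        (change true (not a) + (change (not a) (not b) + change (not b) true)) + W
          ≡⟨ cong₂ _+_ (edge-cost a b) (walk-handle vs c) ⟩
        ((bit a + bit b) + (bit (a ∧ not b) + bit (b ∧ not a))) + (count (inS S) es + count leaves es)
          ≡⟨ arrange₂ (bit a) (bit b) (bit (a ∧ not b)) (bit (b ∧ not a)) (count (inS S) es) (count leaves es) ⟩
        (bit a + (bit b + count (inS S) es)) + (bit (a ∧ not b) + (bit (b ∧ not a) + count leaves es))
          ≡⟨ cong₂ _+_ (count-pair (inS S)) (trans (count-pair leaves)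
                (cong (λ x → bit (a ∧ not b) + (bit (b ∧ not (inS S x)) + count leaves es)) (involutive M v))) ⟨
        count (inS S) (v ∷ p v ∷ es) + count leaves (v ∷ p v ∷ es) ∎
        where
        a = inS S v
        b = inS S (p v)
        es = concatMap (λ v → v ∷ p v ∷ []) vs
        W = changes (handleHalf S) true (concatMap halfOrder vs ∷ʳ (c , lower))
        count-pair : ∀ q → count q (v ∷ p v ∷ es) ≡ bit (q v) + (bit (q (p v)) + count q es)
        count-pair q = trans (count-∷ q v (p v ∷ es)) (cong (bit (q v) +_) (count-∷ q (p v) es))
        arrange₁ : ∀ x y z w → 0 + (x + (y + (z + w))) ≡ (x + (y + z)) + w
        arrange₁ = solve-∀
        arrange₂ : ∀ x y z w s l → ((x + y) + (z + w)) + (s + l) ≡ (x + (y + s)) + (z + (w + l))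
        arrange₂ = solve-∀

      cyc-handle : ∀ vs → let es = concatMap (λ v → v ∷ p v ∷ []) vs in
                   cyc (handleHalf S) (concatMap halfOrder vs) ≡ count (inS S) es + count leaves es
      cyc-handle []       = refl
      cyc-handle (v ∷ vs) =
        trans (cyc-closed (handleHalf S) (v , lower) ((v , upper) ∷ (p v , upper) ∷ (p v , lower) ∷ concatMap halfOrder vs))
              (walk-handle (v ∷ vs) v)

      -- The handle is crossed |S| times inside the columns and |δ(S) ∩ M| times between them.
      cut-handle : 1 ≤ h → 1 ≤ r → cutTour (handleFor S) tour ≡ ∣ S ∣ + cutMatching S M
      cut-handle h≥1 r≥1 = begin
        cutTour (handleFor S) tour
          ≡⟨ cut-cyc (handleFor S) ⟩
        cyc (inS (handleFor S)) tourOrder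
          ≡⟨ cyc-halves h≥1 r≥1 (inS (handleFor S)) (handleHalf S) (handleFor-vertex S) ⟩
        cyc (handleHalf S) (concatMap halfOrder lowerEnds)
          ≡⟨ cyc-handle lowerEnds ⟩
        count (inS S) edgeOrder + count leaves edgeOrder
          ≡⟨ cong₂ _+_ (count-↭ (inS S) edgeOrder-↭) (count-↭ leaves edgeOrder-↭) ⟩
        count (inS S) (allFin m) + count leaves (allFin m)
          ≡⟨ cong (_+ cutMatching S M) (card-count S) ⟨
        ∣ S ∣ + cutMatching S M ∎

  toothAt-column : ∀ {u w} → w ∈ toothAt u → proj₁ (remQuot t w) ≡ u
  toothAt-column {u} {w} w∈ =
    ∈⁅⁆⇒≡ {u = u} (trans (sym (lookup∘tabulate _ w)) (∈⇒inS w∈))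

  card-tooth : ∀ u → ∣ toothAt u ∣ ≡ t
  card-tooth u = begin
    ∣ toothAt u ∣                                                 ≡⟨ card-columns (toothAt u) _ (toothAt-vertex u) ⟩
    sum (tabulate (λ c → count (λ _ → inS ⁅ u ⁆ c) (allFin t)))  ≡⟨ sum-point u _ outside ⟩
    count (λ _ → inS ⁅ u ⁆ u) (allFin t)                          ≡⟨ cong (λ b → count (λ _ → b) (allFin t)) (u∈⁅u⁆ u) ⟩
    count (λ _ → true) (allFin t)                                 ≡⟨ count-true (allFin t) ⟩
    length (allFin t)                                             ≡⟨ length-tabulate (λ j → j) ⟩
    t ∎
    where
    outside : ∀ c → c ≢ u → count (λ _ → inS ⁅ u ⁆ c) (allFin t) ≡ 0
    outside c c≢u = trans (cong (λ b → count (λ _ → b) (allFin t)) (∉⁅u⁆ c≢u)) (count-false (allFin t))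

  count-halves : (g : Half → Bool) →
                 count (λ j → g (half j)) (allFin t) ≡ count (λ _ → g lower) (allFin h) + count (λ _ → g upper) (allFin r)
  count-halves g = begin
    count (λ j → g (half j)) (allFin t)
      ≡⟨ cong (count (λ j → g (half j))) (tabulate-++ h (λ j → j)) ⟩
    count (λ j → g (half j)) (tabulate (_↑ˡ r) ++ tabulate (h ↑ʳ_))
      ≡⟨ count-++ _ (tabulate (_↑ˡ r)) (tabulate (h ↑ʳ_)) ⟩
    count (λ j → g (half j)) (tabulate (_↑ˡ r)) + count (λ j → g (half j)) (tabulate (h ↑ʳ_))
      ≡⟨ cong₂ _+_
           (trans (count-tabulate (λ j → g (half j)) (_↑ˡ r)) (count-cong (λ i → cong g (half-lower i)) (allFin h)))
           (trans (count-tabulate (λ j → g (half j)) (h ↑ʳ_)) (count-cong (λ i → cong g (half-upper i)) (allFin r))) ⟩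
    count (λ _ → g lower) (allFin h) + count (λ _ → g upper) (allFin r) ∎

  card-handle-tooth : ∀ S u → inS S u ≡ true → ∣ handleFor S ∩ toothAt u ∣ ≡ h
  card-handle-tooth S u u∈S = begin
    ∣ handleFor S ∩ toothAt u ∣                           ≡⟨ card-columns (handleFor S ∩ toothAt u) φ ∩-vertex ⟩
    sum (tabulate (λ c → count (φ c) (allFin t)))         ≡⟨ sum-point u _ outside ⟩
    count (φ u) (allFin t)
      ≡⟨ count-cong (λ j → trans (cong (handleHalf S (u , half j) ∧_) (u∈⁅u⁆ u)) (∧-identityʳ _)) (allFin t) ⟩
    count (λ j → handleHalf S (u , half j)) (allFin t)    ≡⟨ count-halves (λ x → handleHalf S (u , x)) ⟩
    count (λ _ → true) (allFin h) + count (λ _ → not (inS S u)) (allFin r)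
      ≡⟨ cong₂ _+_ (trans (count-true (allFin h)) (length-tabulate (λ i → i)))
                   (trans (cong (λ b → count (λ _ → not b) (allFin r)) u∈S) (count-false (allFin r))) ⟩
    h + 0                                                 ≡⟨ +-identityʳ h ⟩
    h ∎
    where
    φ : Fin m → Fin t → Bool
    φ c j = handleHalf S (c , half j) ∧ inS ⁅ u ⁆ c
    ∩-vertex : ∀ c j → inS (handleFor S ∩ toothAt u) (vertex c j) ≡ φ c j
    ∩-vertex c j = trans (inS-∩ (handleFor S) (toothAt u) (vertex c j))
                         (cong₂ _∧_ (handleFor-vertex S c j) (toothAt-vertex u c j))
    outside : ∀ c → c ≢ u → count (φ c) (allFin t) ≡ 0
    outside c c≢u = trans (count-cong (λ j → trans (cong (handleHalf S (c , half j) ∧_) (∉⁅u⁆ c≢u)) (∧-zeroʳ _)) (allFin t))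
                          (count-false (allFin t))

  members : Subset m → List (Fin m)
  members S = filter (λ v → T? (inS S v)) (allFin m)

  memberAt : ∀ S → Fin (length (members S)) → Fin m
  memberAt S = lookup (members S)

  memberAt-∈ : ∀ S i → inS S (memberAt S i) ≡ true
  memberAt-∈ S i = Equivalence.to T-≡ (proj₂ (∈-filter⁻ (λ v → T? (inS S v)) {xs = allFin m} (∈-lookup i)))

  memberAt-injective : ∀ S i j → memberAt S i ≡ memberAt S j → i ≡ j
  memberAt-injective S = lookup-injective (Unique.filter⁺ (λ v → T? (inS S v)) (Unique.allFin⁺ m))

  combFor : Subset m → Comb (m * t)
  combFor S = record { handle = handleFor S ; k = length (members S) ; teeth = λ i → toothAt (memberAt S i) }

  teeth-count : ∀ S → k (combFor S) ≡ ∣ S ∣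
  teeth-count S = sym (card-count S)

  -- a column outside S exists, since |S| is odd and m is even
  outside-column : ∀ S → PerfectMatching m → Odd ∣ S ∣ → ∃ λ z → inS S z ≡ false
  outside-column S M odd with ¬∀⟶∃¬ m (λ z → inS S z ≡ true) (λ z → inS S z Bool.≟ true) all-in⇒⊥
    where
    all-in⇒⊥ : (∀ z → inS S z ≡ true) → ⊥
    all-in⇒⊥ all-in = 0≢1 (begin
      0                                     ≡⟨ m*n%n≡0 (length lowerEnds) 2 ⟨
      (length lowerEnds * 2) % 2            ≡⟨ cong (_% 2) even ⟨
      m % 2                                 ≡⟨ cong (_% 2) card-S ⟨
      ∣ S ∣ % 2                             ≡⟨ odd ⟩
      1 ∎)
      where
      open EdgeOrder M
      0≢1 : 0 ≢ 1
      0≢1 ()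
      card-S : ∣ S ∣ ≡ m
      card-S = trans (card-count S)
                 (trans (count-cong all-in (allFin m)) (trans (count-true (allFin m)) (length-tabulate (λ z → z))))
  ... | z , z∉S = z , ¬-not z∉S

  bottom : 1 ≤ h → Fin t
  bottom h≥1 = fromℕ< h≥1 ↑ˡ r

  bottom-in-handle : ∀ h≥1 S c → inS (handleFor S) (vertex c (bottom h≥1)) ≡ true
  bottom-in-handle h≥1 S c = trans (handleFor-vertex S c _) (cong (λ x → handleHalf S (c , x)) (half-lower _))

  column-of-vertex : ∀ c j → proj₁ (remQuot t (vertex c j)) ≡ c
  column-of-vertex c j = cong proj₁ (remQuot-combine c j)

  -- For odd S with |S| ≥ 3 this is an (h, t)-uniform comb: every tooth has t
  -- vertices, h of them in the handle, and the bottom of a column outside S lies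
  -- in the handle but in no tooth.
  combFor-uniform : 1 ≤ h → (S : Subset m) → PerfectMatching m → Odd ∣ S ∣ → 3 ≤ ∣ S ∣ →
                    IsUniformComb h t (combFor S)
  combFor-uniform h≥1 S M odd three =
    ( subst (3 ≤_) (sym (teeth-count S)) three , subst Odd (sym (teeth-count S)) odd
    , meets-handle , disjoint , outside-teeth )
    , (λ i → card-tooth (u i)) , (λ i → card-handle-tooth S (u i) (memberAt-∈ S i))
    where
    u = memberAt S
    meets-handle : ∀ i → Nonempty (handleFor S ∩ toothAt (u i))
    meets-handle i = vertex (u i) (bottom h≥1) , inS⇒∈ (trans (inS-∩ (handleFor S) (toothAt (u i)) _)
      (cong₂ _∧_ (bottom-in-handle h≥1 S (u i)) (trans (toothAt-vertex (u i) (u i) _) (u∈⁅u⁆ (u i)))))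
    disjoint : ∀ i j → i ≢ j → ∀ w → w ∈ toothAt (u i) → w ∉ toothAt (u j)
    disjoint i j i≢j w w∈i w∈j =
      i≢j (memberAt-injective S i j (trans (sym (toothAt-column w∈i)) (toothAt-column w∈j)))
    outside-teeth : ∃ λ w → w ∈ handleFor S × (∀ i → w ∉ toothAt (u i))
    outside-teeth with outside-column S M odd
    ... | z , z∉S = vertex z (bottom h≥1) , inS⇒∈ (bottom-in-handle h≥1 S z) , not-tooth
      where
      not-tooth : ∀ i → vertex z (bottom h≥1) ∉ toothAt (u i)
      not-tooth i w∈ = false≢true (trans (sym z∉S) (trans (cong (inS S) z≡ui) (memberAt-∈ S i)))
        where
        z≡ui : z ≡ u i
        z≡ui = trans (sym (column-of-vertex z _)) (toothAt-column w∈)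
        false≢true : false ≢ true
        false≢true ()

  comb-slack : 1 ≤ h → 1 ≤ r → ∀ S (M : PerfectMatching m) → slComb (combFor S) (MatchingTour.tour M) ≡ slOdd S M
  comb-slack h≥1 r≥1 S M = begin
    (cutTour (handleFor S) tour + sumFin (λ i → cutTour (toothAt (u i)) tour)) ⊖ (3 * k (combFor S) + 1)
      ≡⟨ cong₂ _⊖_ (cong₂ _+_ (cut-handle S h≥1 r≥1) teeth-cuts) (cong (λ n → 3 * n + 1) (teeth-count S)) ⟩
    (∣ S ∣ + cutMatching S M + ∣ S ∣ * 2) ⊖ (3 * ∣ S ∣ + 1)
      ≡⟨ cong (_⊖ (3 * ∣ S ∣ + 1)) (arrange ∣ S ∣ (cutMatching S M)) ⟩
    (3 * ∣ S ∣ + cutMatching S M) ⊖ (3 * ∣ S ∣ + 1)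
      ≡⟨ +-cancelˡ-⊖ (3 * ∣ S ∣) (cutMatching S M) 1 ⟩
    cutMatching S M ⊖ 1 ∎
    where
    open MatchingTour M
    u = memberAt S
    teeth-cuts : sumFin (λ i → cutTour (toothAt (u i)) tour) ≡ ∣ S ∣ * 2
    teeth-cuts = begin
      sum (map (λ i → cutTour (toothAt (u i)) tour) (allFin (k (combFor S))))
        ≡⟨ cong sum (map-cong (λ i → cut-tooth h≥1 r≥1 (u i)) (allFin _)) ⟩
      sum (map (λ _ → 2) (allFin (k (combFor S))))
        ≡⟨ sum-const 2 (allFin (k (combFor S))) ⟩
      length (allFin (k (combFor S))) * 2
        ≡⟨ cong (_* 2) (trans (length-tabulate (λ i → i)) (teeth-count S)) ⟩
      ∣ S ∣ * 2 ∎
    arrange : ∀ s c → s + c + s * 2 ≡ 3 * s + c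
    arrange = solve-∀

split-levels : ∀ {h t} → h < t → ∃ λ r → 1 ≤ r × h + r ≡ t
split-levels {h} h<t with m≤n⇒∃[o]m+o≡n h<t
... | o , refl = suc o , s≤s z≤n , +-suc h o

lemma1 : (n t h m : ℕ) → 1 ≤ n → 2 ≤ t → n ≡ t * m → 1 ≤ h → h < t →
    Σ (Subset m → Fin m → Fin m → Fin m → Fin m → Comb n) λ combOf →
    Σ (PerfectMatching m → Tour n) λ tourOf →
    (S : Subset m) (M : PerfectMatching m) (w₁ w₂ w₃ w₄ : Fin m) →
    Odd ∣ S ∣ → 5 ≤ ∣ S ∣ →
    w₁ ∈ S → w₂ ∈ S → w₃ ∈ S → w₄ ∈ S →
    w₁ ≢ w₂ → w₁ ≢ w₃ → w₁ ≢ w₄ → w₂ ≢ w₃ → w₂ ≢ w₄ → w₃ ≢ w₄ →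
    InMatching M w₁ w₂ → InMatching M w₃ w₄ →
    IsUniformComb h t (combOf S w₁ w₂ w₃ w₄)
    × slComb (combOf S w₁ w₂ w₃ w₄) (tourOf M) ≡ slOdd S M
lemma1 n t h m _ _ n≡tm h≥1 h<t with split-levels h<t
... | r , r≥1 , refl with trans n≡tm (*-comm t m)
... | refl =
  (λ S _ _ _ _ → combFor S) , MatchingTour.tour ,
  λ S M _ _ _ _ odd five _ _ _ _ _ _ _ _ _ _ _ _ →
    combFor-uniform h≥1 S M odd (≤-trans (s≤s (s≤s (s≤s z≤n))) five) , comb-slack h≥1 r≥1 S M
  where open Prism m h r
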